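{- If there exists a $(1,1;3)$-frame of type $t^m$, three mutually orthogonal Latin squares of order $n$, and an $\mathrm{NR}^*\mathrm{DSTS}(tn+1)$, then there exists an $\mathrm{NR}^*\mathrm{DSTS}(tmn+1)$.
   Context: A $(1,1;3)$-frame with group partition $\{G_1,\dots,G_m\}$ of a $w$-set $V$ (each $|G_i|$ even) is a square array $F$ of side $w/2$, rows and columns indexed by $0,\dots,w/2-1$, such that: each cell is empty or contains a 3-subset of $V$; with $t_i=|G_i|/2$, $g_k=\sum_{i\le k}t_i$, $g_0=0$, the $t_i\times t_i$ subsquare indexed by $g_{i-1},\dots,g_i-1$ is empty; for $x\in\{g_{i-1},\dots,g_i-1\}$, row $x$ and column $x$ each contain every element of $V\setminus G_i$ exactly once; and the 3-subsets in nonempty cells form a group divisible design with groups $G_1,\dots,G_m$, block size 3, index 1 (each block meets each group in at most one point, and every pair of points in distinct groups lies in exactly one block). A frame of type $t^m$ has $m$ groups each of size $t$. An $\mathrm{STS}(u)$ is a pair $(U,\mathcal{A})$ with $|U|=u$ and $\mathcal{A}$ a family of 3-subsets such that every pair of distinct elements lies in exactly one block. A $\mathrm{DSTS}(u)$ is the block collection consisting of two (distinct, labeled) copies of each block of an $\mathrm{STS}(u)$. A near resolution is a partition of the blocks into classes such that each class consists of pairwise disjoint blocks covering $U$ minus exactly one element, and each element is missed by exactly one class; it is self-orthogonal if for any two distinct classes $R_i,R_j$, regarding classes as sets of 3-subsets, $|R_i\cap R_j|\le 1$. An $\mathrm{NR}^*\mathrm{DSTS}(u)$ is a $\mathrm{DSTS}(u)$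 with a self-orthogonal near resolution. -}

module Defs where

open import Data.Nat using (ℕ; _*_)
open import Data.Fin using (Fin)
open import Data.Bool using (Bool)
open import Data.Maybe using (Maybe; just; nothing)
open import Data.Product using (Σ; _×_; _,_; proj₁)
open import Data.Sum using (_⊎_)
open import Relation.Nullary using (¬_)
open import Relation.Binary.PropositionalEquality using (_≡_; _≢_)

ExactlyOne : (A : Set) → (A → Set) → Set
ExactlyOne A P = Σ A (λ a → P a × (∀ a' → P a' → a' ≡ a))

-- 3-subsets of a set V, represented by three pairwise distinct points

record Triple (V : Set) : Set where
  constructor triple
  field
    a b c : V
    a≢b : a ≢ b
    a≢c : a ≢ c
    b≢c : b ≢ c

open Triple public

_∈₃_ : {V : Set} → V → Triple V → Set
x ∈₃ T = x ≡ a T ⊎ (x ≡ b T ⊎ x ≡ c T)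

SameSet : {V : Set} → Triple V → Triple V → Set
SameSet {V} T U = ∀ (x : V) → (x ∈₃ T → x ∈₃ U) × (x ∈₃ U → x ∈₃ T)

IsSTS : (u b : ℕ) → (Fin b → Triple (Fin u)) → Set
IsSTS u b B = ∀ (x y : Fin u) → x ≢ y →
  ExactlyOne (Fin b) (λ k → (x ∈₃ B k) × (y ∈₃ B k))

-- NR*DSTS(u): an STS(u) with blocks B; the DSTS has the two labeled
-- copies (k , false), (k , true) of each block B k; a self-orthogonal
-- near resolution given by a class assignment cls into k classes.
record NRDSTS (u : ℕ) : Set where
  field
    nblocks : ℕ
    blocks  : Fin nblocks → Triple (Fin u)
    isSTS   : IsSTS u nblocks blocks
    nclasses : ℕ
    cls     : Fin nblocks × Bool → Fin nclasses
  blk : Fin nblocks × Bool → Triple (Fin u)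
  blk β = blocks (proj₁ β)
  Misses : Fin nclasses → Fin u → Set
  Misses r e = ∀ β → cls β ≡ r → ¬ (e ∈₃ blk β)
  field
    nearParallel : ∀ (r : Fin nclasses) → Σ (Fin u) (λ e → Misses r e ×
      (∀ x → x ≢ e → ExactlyOne (Fin nblocks × Bool)
                        (λ β → (cls β ≡ r) × (x ∈₃ blk β))))
    missedOnce : ∀ (x : Fin u) → ExactlyOne (Fin nclasses) (λ r → Misses r x)
    -- self-orthogonality: distinct classes share at most one 3-subset
    selfOrth : ∀ (r r' : Fin nclasses) → r ≢ r' →
      ∀ β₁ β₂ β₁' β₂' → cls β₁ ≡ r → cls β₂ ≡ r → cls β₁' ≡ r' → cls β₂' ≡ r' →
      SameSet (blk β₁) (blk β₁') → SameSet (blk β₂) (blk β₂') →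
      SameSet (blk β₁) (blk β₂)

IsLatin : (n : ℕ) → (Fin n → Fin n → Fin n) → Set
IsLatin n L =
  (∀ r s → ExactlyOne (Fin n) (λ c → L r c ≡ s)) ×
  (∀ c s → ExactlyOne (Fin n) (λ r → L r c ≡ s))

Orthogonal : (n : ℕ) → (Fin n → Fin n → Fin n) → (Fin n → Fin n → Fin n) → Set
Orthogonal n L M = ∀ s s' →
  ExactlyOne (Fin n × Fin n) (λ rc → (L (proj₁ rc) (Data.Product.proj₂ rc) ≡ s)
                                   × (M (proj₁ rc) (Data.Product.proj₂ rc) ≡ s'))

ThreeMOLS : ℕ → Set
ThreeMOLS n = Σ (Fin 3 → Fin n → Fin n → Fin n) (λ L →
  (∀ i → IsLatin n (L i)) × (∀ i j → i ≢ j → Orthogonal n (L i) (L j)))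

-- Point set V = Fin m × Fin t, group G_i = { (i , _) }.  Since |G_i| = t
-- must be even, t = 2 * s; rows/columns are indexed by Fin m × Fin s,
-- where index (i , a) stands for row g_{i-1} + a, so the rows of group i
-- are exactly those with first component i.

record Frame (t m : ℕ) : Set where
  field
    s    : ℕ
    t≡2s : t ≡ 2 * s
  Pt  : Set
  Pt  = Fin m × Fin t
  Idx : Set
  Idx = Fin m × Fin s
  field
    F : Idx → Idx → Maybe (Triple Pt)
  InCell : Idx → Idx → Pt → Set
  InCell x y p = Σ (Triple Pt) (λ T → (F x y ≡ just T) × (p ∈₃ T))
  field
    holes   : ∀ i a a' → F (i , a) (i , a') ≡ nothing
    rowCond : ∀ (x : Idx) (p : Pt) → proj₁ p ≢ proj₁ x →
      ExactlyOne Idx (λ y → InCell x y p)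
    colCond : ∀ (y : Idx) (p : Pt) → proj₁ p ≢ proj₁ y →
      ExactlyOne Idx (λ x → InCell x y p)
    transversal : ∀ x y T → F x y ≡ just T →
      (proj₁ (a T) ≢ proj₁ (b T)) × (proj₁ (a T) ≢ proj₁ (c T)) × (proj₁ (b T) ≢ proj₁ (c T))
    pairCond : ∀ (p q : Pt) → proj₁ p ≢ proj₁ q →
      ExactlyOne (Idx × Idx) (λ xy → Σ (Triple Pt) (λ T →
        (F (proj₁ xy) (Data.Product.proj₂ xy) ≡ just T) × (p ∈₃ T) × (q ∈₃ T)))

-- The new design lives on ∞ together with (frame points) × Fin n.  Each group G_i × Fin n
-- together with ∞ carries a copy of the given NR*DSTS(tn+1), and each frame block
-- {p₀ , p₁ , p₂} is inflated to the n² blocks {(p_k , L_k(ρ , σ))}; orthogonality of the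
-- Latin squares L_k makes these a transversal design, so altogether we get an STS(tmn+1).
-- Since |G_i| = 2s, the points of G_i × Fin n correspond to pairs (row or column of the hole
-- of G_i, symbol α).  The class missing such a point consists of the inflated blocks of that
-- row (column) whose Latin row (column) index is α, which cover every point outside the group
-- once, together with the inner class missing the point; the class missing ∞ is the union of
-- the inner classes missing ∞.  An inflated block lies in the class of its row and in that of
-- its column, and these belong to different groups because the holes are empty: this gives
-- self-orthogonality.

module Submission where

open import Defs
open import Data.Bool using (Bool; true; false; T; if_then_else_)
open import Data.Empty using (⊥; ⊥-elim)
open import Data.Fin using (Fin; zero; suc; _≟_; punchIn; punchOut)
open import Data.Fin.Properties
  using (*↔×; +↔⊎; 0↔⊥; 1↔⊤; 2↔Bool; injective⇒≤; punchIn-injective; punchInᵢ≢i; punchOut-injective)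
open import Data.Maybe using (Maybe; just; nothing; maybe; is-just)
open import Data.Maybe.Properties using (just-injective)
open import Data.Bool.Properties using (T-irrelevant)
open import Data.Nat using (ℕ; zero; suc; _+_; _*_)
open import Data.Nat.Properties using (n≮n; +-comm)
open import Data.Product using (Σ; ∃-syntax; _×_; _,_; proj₁; proj₂)
open import Data.Product.Function.Dependent.Propositional using (Σ-↔)
open import Data.Product.Function.NonDependent.Propositional using (_×-↔_)
open import Data.Sum using (_⊎_; inj₁; inj₂)
import Data.Sum as Sum
open import Data.Sum.Function.Propositional using (_⊎-↔_)
open import Function using (_∘_)
open import Function.Bundles using (_↔_; mk↔ₛ′; Inverse; Injection)
open import Function.Definitions using (Injective)
open import Function.Properties.Inverse using (↔-refl; ↔-sym; ↔-trans; ↔⇒↣)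
open import Function.Related.TypeIsomorphisms using (×-comm)
open import Relation.Binary.PropositionalEquality
open import Relation.Nullary using (¬_; yes; no)

open Inverse using (to; from; strictlyInverseˡ; strictlyInverseʳ)

private
  variable
    A B X Y : Set

to-injective : (e : A ↔ B) → Injective _≡_ _≡_ (to e)
to-injective e = Injection.injective (↔⇒↣ e)

Finite : Set → Set
Finite A = ∃[ N ] (A ↔ Fin N)

Finite-Fin : ∀ k → Finite (Fin k)
Finite-Fin k = k , ↔-refl

Finite-× : Finite A → Finite B → Finite (A × B)
Finite-× (a , eA) (b , eB) = a * b , ↔-trans (eA ×-↔ eB) (↔-sym *↔×)

Finite-⊎ : Finite A → Finite B → Finite (A ⊎ B)
Finite-⊎ (a , eA) (b , eB) = a + b , ↔-trans (eA ⊎-↔ eB) (↔-sym +↔⊎)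

Finite-Maybe : Finite A → Finite (Maybe A)
Finite-Maybe (k , e) = suc k , mk↔ₛ′
  (maybe (suc ∘ to e) zero)
  (λ { zero → nothing ; (suc i) → just (from e i) })
  (λ { zero → refl ; (suc i) → cong suc (strictlyInverseˡ e i) })
  (λ { nothing → refl ; (just x) → cong just (strictlyInverseʳ e x) })

Maybe↔Fin-+1 : ∀ {k} → A ↔ Fin k → Maybe A ↔ Fin (k + 1)
Maybe↔Fin-+1 {A} {k} e = subst (λ j → Maybe A ↔ Fin j) (+-comm 1 k) (proj₂ (Finite-Maybe (k , e)))

T↔Fin : ∀ b → T b ↔ Fin (if b then 1 else 0)
T↔Fin false = ↔-sym 0↔⊥
T↔Fin true  = ↔-sym 1↔⊤

Σ-Fin-suc↔ : ∀ {k} (P : Fin (suc k) → Set) →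
  Σ (Fin (suc k)) P ↔ (P zero ⊎ Σ (Fin k) (P ∘ suc))
Σ-Fin-suc↔ P = mk↔ₛ′
  (λ { (zero , p) → inj₁ p ; (suc i , p) → inj₂ (i , p) })
  (λ { (inj₁ p) → zero , p ; (inj₂ (i , p)) → suc i , p })
  (λ { (inj₁ p) → refl ; (inj₂ (i , p)) → refl })
  (λ { (zero , p) → refl ; (suc i , p) → refl })

Finite-Σ-Fin-T : ∀ {k} (f : Fin k → Bool) → Finite (Σ (Fin k) (T ∘ f))
Finite-Σ-Fin-T {zero} f = 0 , mk↔ₛ′ (λ { (() , _) }) (λ ()) (λ ()) (λ { (() , _) })
Finite-Σ-Fin-T {suc k} f with Finite-Σ-Fin-T (f ∘ suc)
... | N , e = _ ,
  ↔-trans (Σ-Fin-suc↔ (T ∘ f)) (↔-trans (T↔Fin (f zero) ⊎-↔ e) (↔-sym +↔⊎))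

Finite-Σ-T : (f : A → Bool) → Finite A → Finite (Σ A (T ∘ f))
Finite-Σ-T f (k , e) with Finite-Σ-Fin-T (f ∘ from e)
... | N , e′ = N , ↔-trans (↔-sym (Σ-↔ (↔-sym e) ↔-refl)) e′

no-injection-from-Maybe : Finite A → (f : Maybe A → A) → ¬ Injective _≡_ _≡_ f
no-injection-from-Maybe (k , e) f f-inj = n≮n k (injective⇒≤ {f = to e ∘ f ∘ from e′} g-inj)
  where
  e′ = proj₂ (Finite-Maybe (k , e))
  g-inj : Injective _≡_ _≡_ (to e ∘ f ∘ from e′)
  g-inj = to-injective (↔-sym e′) ∘ f-inj ∘ to-injective e

point : Triple X → Fin 3 → X
point T zero             = a T
point T (suc zero)       = b T
point T (suc (suc zero)) = c T

∈⇒point : {x : X} (T : Triple X) → x ∈₃ T → ∃[ k ] x ≡ point T k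
∈⇒point T (inj₁ x≡a)        = zero , x≡a
∈⇒point T (inj₂ (inj₁ x≡b)) = suc zero , x≡b
∈⇒point T (inj₂ (inj₂ x≡c)) = suc (suc zero) , x≡c

point∈ : (T : Triple X) (k : Fin 3) → point T k ∈₃ T
point∈ T zero             = inj₁ refl
point∈ T (suc zero)       = inj₂ (inj₁ refl)
point∈ T (suc (suc zero)) = inj₂ (inj₂ refl)

point-injective-on : (g : X → Y) (T : Triple X) →
  g (a T) ≢ g (b T) → g (a T) ≢ g (c T) → g (b T) ≢ g (c T) → Injective _≡_ _≡_ (g ∘ point T)
point-injective-on g T ab ac bc = injective
  where
  injective : Injective _≡_ _≡_ (g ∘ point T)
  injective {zero}           {zero}           _ = refl
  injective {zero}           {suc zero}       p = ⊥-elim (ab p)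
  injective {zero}           {suc (suc zero)} p = ⊥-elim (ac p)
  injective {suc zero}       {zero}           p = ⊥-elim (ab (sym p))
  injective {suc zero}       {suc zero}       _ = refl
  injective {suc zero}       {suc (suc zero)} p = ⊥-elim (bc p)
  injective {suc (suc zero)} {zero}           p = ⊥-elim (ac (sym p))
  injective {suc (suc zero)} {suc zero}       p = ⊥-elim (bc (sym p))
  injective {suc (suc zero)} {suc (suc zero)} _ = refl

point-injective : (T : Triple X) → Injective _≡_ _≡_ (point T)
point-injective T = point-injective-on (λ x → x) T (a≢b T) (a≢c T) (b≢c T)

distinct-positions : ∀ {T : Triple X} {x y k k′} →
  x ≡ point T k → y ≡ point T k′ → x ≢ y → k ≢ k′
distinct-positions x≡ y≡ x≢y refl = x≢y (trans x≡ (sym y≡))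

otherPosition : Fin 3 → Bool → Fin 3
otherPosition k b = punchIn k (from 2↔Bool b)

otherPosition-≢ : ∀ k b → otherPosition k b ≢ k
otherPosition-≢ k b = punchInᵢ≢i k (from 2↔Bool b)

otherPosition-injective : ∀ k → Injective _≡_ _≡_ (otherPosition k)
otherPosition-injective k = to-injective (↔-sym 2↔Bool) ∘ punchIn-injective k _ _

tabulateTriple : (f : Fin 3 → X) → Injective _≡_ _≡_ f → Triple X
tabulateTriple f f-inj = triple (f zero) (f (suc zero)) (f (suc (suc zero)))
  ((λ ()) ∘ f-inj) ((λ ()) ∘ f-inj) ((λ ()) ∘ f-inj)

∈-tabulateTriple⁺ : (f : Fin 3 → X) (f-inj : Injective _≡_ _≡_ f) (k : Fin 3) →
  f k ∈₃ tabulateTriple f f-inj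
∈-tabulateTriple⁺ f f-inj zero             = inj₁ refl
∈-tabulateTriple⁺ f f-inj (suc zero)       = inj₂ (inj₁ refl)
∈-tabulateTriple⁺ f f-inj (suc (suc zero)) = inj₂ (inj₂ refl)

∈-tabulateTriple⁻ : {x : X} (f : Fin 3 → X) (f-inj : Injective _≡_ _≡_ f) →
  x ∈₃ tabulateTriple f f-inj → ∃[ k ] x ≡ f k
∈-tabulateTriple⁻ f f-inj (inj₁ x≡a)        = zero , x≡a
∈-tabulateTriple⁻ f f-inj (inj₂ (inj₁ x≡b)) = suc zero , x≡b
∈-tabulateTriple⁻ f f-inj (inj₂ (inj₂ x≡c)) = suc (suc zero) , x≡c

mapTriple : (f : X → Y) → Injective _≡_ _≡_ f → Triple X → Triple Y
mapTriple f f-inj (triple x y z x≢y x≢z y≢z) =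
  triple (f x) (f y) (f z) (x≢y ∘ f-inj) (x≢z ∘ f-inj) (y≢z ∘ f-inj)

module _ (f : X → Y) (f-inj : Injective _≡_ _≡_ f) where

  ∈-mapTriple⁺ : ∀ {x} T → x ∈₃ T → f x ∈₃ mapTriple f f-inj T
  ∈-mapTriple⁺ (triple _ _ _ _ _ _) = Sum.map (cong f) (Sum.map (cong f) (cong f))

  ∈-mapTriple⁻ : ∀ {y} T → y ∈₃ mapTriple f f-inj T → ∃[ x ] x ∈₃ T × y ≡ f x
  ∈-mapTriple⁻ (triple x _ _ _ _ _) (inj₁ y≡fx)        = x , inj₁ refl , y≡fx
  ∈-mapTriple⁻ (triple _ x _ _ _ _) (inj₂ (inj₁ y≡fx)) = x , inj₂ (inj₁ refl) , y≡fx
  ∈-mapTriple⁻ (triple _ _ x _ _ _) (inj₂ (inj₂ y≡fx)) = x , inj₂ (inj₂ refl) , y≡fx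

  ∈-mapTriple-injective : ∀ {x} T → f x ∈₃ mapTriple f f-inj T → x ∈₃ T
  ∈-mapTriple-injective T fx∈ with ∈-mapTriple⁻ T fx∈
  ... | x′ , x′∈ , fx≡fx′ = subst (_∈₃ T) (sym (f-inj fx≡fx′)) x′∈

SameSet-refl : (T : Triple X) → SameSet T T
SameSet-refl T x = (λ h → h) , (λ h → h)

ExactlyOne-unique : {P : A → Set} → ExactlyOne A P → ∀ {x y} → P x → P y → x ≡ y
ExactlyOne-unique (_ , _ , unique) Px Py = trans (unique _ Px) (sym (unique _ Py))

ExactlyOne-map : {P : A → Set} {Q : B → Set} (e : A ↔ B) →
  (∀ x → P x → Q (to e x)) → (∀ y → Q y → P (from e y)) → ExactlyOne A P → ExactlyOne B Q
ExactlyOne-map e P⇒Q Q⇒P (x , Px , unique) =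
  to e x , P⇒Q x Px ,
  λ y Qy → trans (sym (strictlyInverseˡ e y)) (cong (to e) (unique _ (Q⇒P y Qy)))

ExactlyOne-cong : {P Q : A → Set} →
  (∀ x → P x → Q x) → (∀ x → Q x → P x) → ExactlyOne A P → ExactlyOne A Q
ExactlyOne-cong = ExactlyOne-map ↔-refl

IsSTS-sameSet⇒≡ : {V K : Set} (blocks : K → Triple V) →
  (∀ x y → x ≢ y → ExactlyOne K (λ k → x ∈₃ blocks k × y ∈₃ blocks k)) →
  ∀ {k k′} → SameSet (blocks k) (blocks k′) → k ≡ k′
IsSTS-sameSet⇒≡ blocks sts {k} {k′} same =
  ExactlyOne-unique (sts (a β) (b β) (a≢b β)) (inj₁ refl , inj₂ (inj₁ refl))
    (proj₁ (same (a β)) (inj₁ refl) , proj₁ (same (b β)) (inj₂ (inj₁ refl)))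
  where β = blocks k

-- Near-parallel classes are labelled by the point they miss, and self-orthogonality is stated
-- on block indices (equivalent for an STS by IsSTS-sameSet⇒≡).
record NRStarDSTS (V K : Set) : Set where
  field
    blocks : K → Triple V
    isSTS  : ∀ x y → x ≢ y → ExactlyOne K (λ k → x ∈₃ blocks k × y ∈₃ blocks k)
    cls    : K × Bool → V
  blk : K × Bool → Triple V
  blk β = blocks (proj₁ β)
  field
    missesOwn : ∀ β → ¬ (cls β ∈₃ blk β)
    covers    : ∀ r x → x ≢ r → ExactlyOne (K × Bool) (λ β → cls β ≡ r × x ∈₃ blk β)
    selfOrth  : ∀ {k k′ b₁ b₂ b₁′ b₂′} →
                cls (k , b₁) ≡ cls (k′ , b₂) → cls (k , b₁′) ≡ cls (k′ , b₂′) →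
                cls (k , b₁) ≢ cls (k , b₁′) → k ≡ k′

module MissedPoints {u} (D : NRDSTS u) where
  open NRDSTS D

  missed : Fin nclasses → Fin u
  missed r = proj₁ (nearParallel r)

  missesMissed : ∀ r → Misses r (missed r)
  missesMissed r = proj₁ (proj₂ (nearParallel r))

  missed-unique : ∀ {r e} → Misses r e → e ≡ missed r
  missed-unique {r} {e} misses with e ≟ missed r
  ... | yes e≡ = e≡
  ... | no e≢ with proj₂ (proj₂ (nearParallel r)) e e≢
  ...   | β , (β∈r , e∈β) , _ = ⊥-elim (misses β β∈r e∈β)

  missed-injective : Injective _≡_ _≡_ missed
  missed-injective {r} {r′} eq = ExactlyOne-unique (missedOnce (missed r))
    (missesMissed r) (subst (Misses r′) (sym eq) (missesMissed r′))

  classMissing : ∀ x → ∃[ r ] missed r ≡ x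
  classMissing x = proj₁ (missedOnce x) , sym (missed-unique (proj₁ (proj₂ (missedOnce x))))

fromNRDSTS : ∀ {u} (D : NRDSTS u) → NRStarDSTS (Fin u) (Fin (NRDSTS.nblocks D))
fromNRDSTS D = record
  { blocks = blocks ; isSTS = isSTS ; cls = missed ∘ cls
  ; missesOwn = λ β → missesMissed (cls β) β refl
  ; covers = covers′ ; selfOrth = selfOrth′ }
  where
  open NRDSTS D
  open MissedPoints D

  covers′ : ∀ r x → x ≢ r →
    ExactlyOne (Fin nblocks × Bool) (λ β → missed (cls β) ≡ r × x ∈₃ blk β)
  covers′ r x x≢r with classMissing r
  ... | c , c↦r = ExactlyOne-cong
    (λ β (β∈c , x∈β) → trans (cong missed β∈c) c↦r , x∈β)
    (λ β (β↦r , x∈β) → missed-injective (trans β↦r (sym c↦r)) , x∈β)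
    (proj₂ (proj₂ (nearParallel c)) x (λ x≡ → x≢r (trans x≡ c↦r)))

  selfOrth′ : ∀ {k k′ b₁ b₂ b₁′ b₂′} →
    missed (cls (k , b₁)) ≡ missed (cls (k′ , b₂)) →
    missed (cls (k , b₁′)) ≡ missed (cls (k′ , b₂′)) →
    missed (cls (k , b₁)) ≢ missed (cls (k , b₁′)) → k ≡ k′
  selfOrth′ {k} {k′} {b₁} {b₂} {b₁′} {b₂′} e e′ r≢r′ = IsSTS-sameSet⇒≡ blocks isSTS
    (selfOrth _ _ (r≢r′ ∘ cong missed) (k , b₁) (k′ , b₂) (k , b₁′) (k′ , b₂′)
      refl (sym (missed-injective e)) refl (sym (missed-injective e′))
      (SameSet-refl (blocks k)) (SameSet-refl (blocks k′)))

toNRDSTS : ∀ {u nb} → NRStarDSTS (Fin u) (Fin nb) → NRDSTS u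
toNRDSTS {u} {nb} N = record
  { nblocks = nb ; blocks = blocks ; isSTS = isSTS ; nclasses = u ; cls = cls
  ; nearParallel = λ r → r , missesOwn′ r , covers r
  ; missedOnce = λ x → x , missesOwn′ x , onlyOwn x
  ; selfOrth = selfOrth′ }
  where
  open NRStarDSTS N

  missesOwn′ : ∀ r β → cls β ≡ r → ¬ (r ∈₃ blk β)
  missesOwn′ r β refl = missesOwn β

  onlyOwn : ∀ x r → (∀ β → cls β ≡ r → ¬ (x ∈₃ blk β)) → r ≡ x
  onlyOwn x r misses with r ≟ x
  ... | yes r≡x = r≡x
  ... | no r≢x with covers r x (r≢x ∘ sym)
  ...   | β , (β∈r , x∈β) , _ = ⊥-elim (misses β β∈r x∈β)

  selfOrth′ : ∀ r r′ → r ≢ r′ → ∀ β₁ β₂ β₁′ β₂′ →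
    cls β₁ ≡ r → cls β₂ ≡ r → cls β₁′ ≡ r′ → cls β₂′ ≡ r′ →
    SameSet (blk β₁) (blk β₁′) → SameSet (blk β₂) (blk β₂′) → SameSet (blk β₁) (blk β₂)
  selfOrth′ r r′ r≢r′ (k₁ , b₁) (k₂ , b₂) (k₁′ , b₁′) (k₂′ , b₂′) c₁ c₂ c₁′ c₂′ s₁ s₂
    with IsSTS-sameSet⇒≡ blocks isSTS s₁ | IsSTS-sameSet⇒≡ blocks isSTS s₂
  ... | refl | refl = subst (SameSet (blocks k₁) ∘ blocks)
    (selfOrth (trans c₁ (sym c₂)) (trans c₁′ (sym c₂′))
              (λ eq → r≢r′ (trans (sym c₁) (trans eq c₁′))))
    (SameSet-refl (blocks k₁))

relabel : NRStarDSTS X A → X ↔ Y → A ↔ B → NRStarDSTS Y B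
relabel {X} {A} {Y} {B} N eV eK = record
  { blocks = blocks′ ; isSTS = isSTS′ ; cls = cls′
  ; missesOwn = missesOwn′ ; covers = covers′ ; selfOrth = selfOrth′ }
  where
  open NRStarDSTS N

  eKB : (A × Bool) ↔ (B × Bool)
  eKB = eK ×-↔ ↔-refl

  blocks′ : B → Triple Y
  blocks′ k = mapTriple (to eV) (to-injective eV) (blocks (from eK k))

  cls′ : B × Bool → Y
  cls′ (k , d) = to eV (cls (from eK k , d))

  ∈blocks′⁻ : ∀ {y} k → y ∈₃ blocks′ k → from eV y ∈₃ blocks (from eK k)
  ∈blocks′⁻ {y} k y∈ with ∈-mapTriple⁻ (to eV) (to-injective eV) (blocks (from eK k)) y∈
  ... | x , x∈ , refl = subst (_∈₃ blocks (from eK k)) (sym (strictlyInverseʳ eV x)) x∈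

  ∈blocks′⁺ : ∀ {y} k → from eV y ∈₃ blocks k → y ∈₃ blocks′ (to eK k)
  ∈blocks′⁺ {y} k y∈ = subst₂ (λ z k′ → z ∈₃ mapTriple (to eV) (to-injective eV) (blocks k′))
    (strictlyInverseˡ eV y) (sym (strictlyInverseʳ eK k))
    (∈-mapTriple⁺ (to eV) (to-injective eV) (blocks k) y∈)

  cls′⇒cls : ∀ {r} k d → cls′ (k , d) ≡ r → cls (from eK k , d) ≡ from eV r
  cls′⇒cls k d refl = sym (strictlyInverseʳ eV _)

  cls⇒cls′ : ∀ {r} k d → cls (k , d) ≡ from eV r → cls′ (to eK k , d) ≡ r
  cls⇒cls′ {r} k d eq = begin
    to eV (cls (from eK (to eK k) , d))
      ≡⟨ cong (λ k′ → to eV (cls (k′ , d))) (strictlyInverseʳ eK k) ⟩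
    to eV (cls (k , d))                  ≡⟨ cong (to eV) eq ⟩
    to eV (from eV r)                    ≡⟨ strictlyInverseˡ eV r ⟩
    r                                    ∎
    where open ≡-Reasoning

  isSTS′ : ∀ x y → x ≢ y → ExactlyOne B (λ k → x ∈₃ blocks′ k × y ∈₃ blocks′ k)
  isSTS′ x y x≢y = ExactlyOne-map eK
    (λ k (x∈ , y∈) → ∈blocks′⁺ k x∈ , ∈blocks′⁺ k y∈)
    (λ k (x∈ , y∈) → ∈blocks′⁻ k x∈ , ∈blocks′⁻ k y∈)
    (isSTS (from eV x) (from eV y) (x≢y ∘ to-injective (↔-sym eV)))

  missesOwn′ : ∀ β → ¬ (cls′ β ∈₃ blocks′ (proj₁ β))
  missesOwn′ (k , d) own = missesOwn (from eK k , d)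
    (subst (_∈₃ blocks (from eK k)) (strictlyInverseʳ eV _) (∈blocks′⁻ k own))

  covers′ : ∀ r y → y ≢ r →
    ExactlyOne (B × Bool) (λ β → cls′ β ≡ r × y ∈₃ blocks′ (proj₁ β))
  covers′ r y y≢r = ExactlyOne-map eKB
    (λ (k , d) (k∈r , y∈) → cls⇒cls′ k d k∈r , ∈blocks′⁺ k y∈)
    (λ (k , d) (k∈r , y∈) → cls′⇒cls k d k∈r , ∈blocks′⁻ k y∈)
    (covers (from eV r) (from eV y) (y≢r ∘ to-injective (↔-sym eV)))

  selfOrth′ : ∀ {k k′ b₁ b₂ b₁′ b₂′} →
    cls′ (k , b₁) ≡ cls′ (k′ , b₂) → cls′ (k , b₁′) ≡ cls′ (k′ , b₂′) →
    cls′ (k , b₁) ≢ cls′ (k , b₁′) → k ≡ k′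
  selfOrth′ e e′ r≢r′ = to-injective (↔-sym eK)
    (selfOrth (to-injective eV e) (to-injective eV e′) (r≢r′ ∘ cong (to eV)))

-- Direction false reads a cell (row , column) along its row, direction true along its column.
cellAt : Bool → A → A → A × A
cellAt false X Y = X , Y
cellAt true  X Y = Y , X

lineOf : Bool → A × A → A
lineOf false = proj₁
lineOf true  = proj₂

crossOf : Bool → A × A → A
crossOf false = proj₂
crossOf true  = proj₁

lineOf-cellAt : ∀ d (X Y : A) → lineOf d (cellAt d X Y) ≡ X
lineOf-cellAt false X Y = refl
lineOf-cellAt true  X Y = refl

cellAt-lineOf-crossOf : ∀ d (c : A × A) → cellAt d (lineOf d c) (crossOf d c) ≡ c
cellAt-lineOf-crossOf false c = refl
cellAt-lineOf-crossOf true  c = refl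

cellAt-≡ : ∀ d {X : A} {Y} {c} → lineOf d c ≡ X → crossOf d c ≡ Y → c ≡ cellAt d X Y
cellAt-≡ d {c = c} refl refl = sym (cellAt-lineOf-crossOf d c)

lineOf-both : ∀ {d d′} → d ≢ d′ → {c c′ : A × A} →
  lineOf d c ≡ lineOf d c′ → lineOf d′ c ≡ lineOf d′ c′ → c ≡ c′
lineOf-both {d = false} {false} d≢d′ _ _ = ⊥-elim (d≢d′ refl)
lineOf-both {d = false} {true}  _ eq eq′ = cong₂ _,_ eq eq′
lineOf-both {d = true}  {false} _ eq eq′ = cong₂ _,_ eq′ eq
lineOf-both {d = true}  {true}  d≢d′ _ _ = ⊥-elim (d≢d′ refl)

fromJust : (mx : Maybe A) → T (is-just mx) → A
fromJust (just x) _ = x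

fromJust-≡ : (mx : Maybe A) (h : T (is-just mx)) → mx ≡ just (fromJust mx h)
fromJust-≡ (just x) _ = refl

≡just⇒is-just : {mx : Maybe A} {x : A} → mx ≡ just x → T (is-just mx)
≡just⇒is-just refl = _

module FrameGeometry {t m : ℕ} (fr : Frame t m) where
  open Frame fr public

  Cell : Set
  Cell = Idx × Idx

  content : Cell → Maybe (Triple Pt)
  content (x , y) = F x y

  _∈Cell_ : Pt → Cell → Set
  p ∈Cell (x , y) = InCell x y p

  lineCond : ∀ d X p → proj₁ p ≢ proj₁ X → ExactlyOne Idx (λ Y → p ∈Cell cellAt d X Y)
  lineCond false = rowCond
  lineCond true  = colCond

  FrameBlock : Set
  FrameBlock = Σ Cell (T ∘ is-just ∘ content)

  tripleOf : FrameBlock → Triple Pt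
  tripleOf (c , h) = fromJust (content c) h

  content-tripleOf : (fb : FrameBlock) → content (proj₁ fb) ≡ just (tripleOf fb)
  content-tripleOf (c , h) = fromJust-≡ (content c) h

  FrameBlock-≡ : {fb fb′ : FrameBlock} → proj₁ fb ≡ proj₁ fb′ → fb ≡ fb′
  FrameBlock-≡ {c , h} {c′ , h′} refl = cong (c ,_) (T-irrelevant h h′)

  frameBlock-rowGroup≢colGroup : (fb : FrameBlock) →
    proj₁ (proj₁ (proj₁ fb)) ≢ proj₁ (proj₂ (proj₁ fb))
  frameBlock-rowGroup≢colGroup (((i , x) , (j , y)) , h) refl = subst (T ∘ is-just) (holes i x y) h

  frameBlock-lineGroups-≢ : ∀ fb {d d′} → d ≢ d′ →
    proj₁ (lineOf d (proj₁ fb)) ≢ proj₁ (lineOf d′ (proj₁ fb))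
  frameBlock-lineGroups-≢ fb {false} {false} d≢d′ = ⊥-elim (d≢d′ refl)
  frameBlock-lineGroups-≢ fb {false} {true}  _    = frameBlock-rowGroup≢colGroup fb
  frameBlock-lineGroups-≢ fb {true}  {false} _    = frameBlock-rowGroup≢colGroup fb ∘ sym
  frameBlock-lineGroups-≢ fb {true}  {true}  d≢d′ = ⊥-elim (d≢d′ refl)

  frameBlockAt : ∀ {c T} → content c ≡ just T → FrameBlock
  frameBlockAt {c} c↦T = c , ≡just⇒is-just c↦T

  tripleOf-frameBlockAt : ∀ {c T} (c↦T : content c ≡ just T) → tripleOf (frameBlockAt c↦T) ≡ T
  tripleOf-frameBlockAt {c} c↦T =
    just-injective (trans (sym (content-tripleOf (frameBlockAt c↦T))) c↦T)

  ∈tripleOf⇒∈Cell : ∀ {p} fb → p ∈₃ tripleOf fb → p ∈Cell proj₁ fb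
  ∈tripleOf⇒∈Cell fb p∈ = tripleOf fb , content-tripleOf fb , p∈

  tripleOf-group-injective : ∀ fb → Injective _≡_ _≡_ (proj₁ ∘ point (tripleOf fb))
  tripleOf-group-injective fb with transversal _ _ (tripleOf fb) (content-tripleOf fb)
  ... | ab , ac , bc = point-injective-on proj₁ (tripleOf fb) ab ac bc

  frameBlock-pair : ∀ {p q} → proj₁ p ≢ proj₁ q →
    ExactlyOne FrameBlock (λ fb → p ∈₃ tripleOf fb × q ∈₃ tripleOf fb)
  frameBlock-pair {p} {q} p≁q with pairCond p q p≁q
  ... | (x , y) , (T , c↦T , p∈T , q∈T) , _ =
    fb , (subst (p ∈₃_) (sym T≡) p∈T , subst (q ∈₃_) (sym T≡) q∈T) , unique
    where
    fb = frameBlockAt {x , y} c↦T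
    T≡ = tripleOf-frameBlockAt {x , y} c↦T
    unique : ∀ fb′ → p ∈₃ tripleOf fb′ × q ∈₃ tripleOf fb′ → fb′ ≡ fb
    unique fb′ (p∈ , q∈) = FrameBlock-≡ (ExactlyOne-unique (pairCond p q p≁q)
      (tripleOf fb′ , content-tripleOf fb′ , p∈ , q∈) (T , c↦T , p∈T , q∈T))

  frameBlock-line : ∀ d X {p} → proj₁ p ≢ proj₁ X →
    ExactlyOne FrameBlock (λ fb → lineOf d (proj₁ fb) ≡ X × p ∈₃ tripleOf fb)
  frameBlock-line d X {p} p≁X with lineCond d X p p≁X
  ... | Y , (T , c↦T , p∈T) , Y-unique =
    fb , (lineOf-cellAt d X Y , subst (p ∈₃_) (sym T≡) p∈T) , unique
    where
    fb = frameBlockAt {cellAt d X Y} c↦T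
    T≡ = tripleOf-frameBlockAt {cellAt d X Y} c↦T
    unique : ∀ fb′ → lineOf d (proj₁ fb′) ≡ X × p ∈₃ tripleOf fb′ → fb′ ≡ fb
    unique fb′ (onX , p∈) =
      FrameBlock-≡ (trans at (cong (cellAt d X) (Y-unique _ (subst (p ∈Cell_) at (∈tripleOf⇒∈Cell fb′ p∈)))))
      where
      at = cellAt-≡ d onX refl

  partner : ∀ {p} fb → p ∈₃ tripleOf fb → Bool → Pt
  partner fb p∈ b = point (tripleOf fb) (otherPosition (proj₁ (∈⇒point (tripleOf fb) p∈)) b)

  partner-∈ : ∀ {p} fb (p∈ : p ∈₃ tripleOf fb) b → partner fb p∈ b ∈₃ tripleOf fb
  partner-∈ fb p∈ b = point∈ (tripleOf fb) (otherPosition (proj₁ (∈⇒point (tripleOf fb) p∈)) b)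

  partner-group-≢ : ∀ {p} fb (p∈ : p ∈₃ tripleOf fb) b → proj₁ (partner fb p∈ b) ≢ proj₁ p
  partner-group-≢ fb p∈ b eq with ∈⇒point (tripleOf fb) p∈
  ... | k , refl = otherPosition-≢ k b (tripleOf-group-injective fb eq)

  partner-injective : ∀ {p} fb (p∈ : p ∈₃ tripleOf fb) → Injective _≡_ _≡_ (partner fb p∈)
  partner-injective fb p∈ =
    otherPosition-injective (proj₁ (∈⇒point (tripleOf fb) p∈)) ∘ point-injective (tripleOf fb)

  halves : Fin t ↔ (Bool × Fin s)
  halves = subst (λ k → Fin k ↔ (Bool × Fin s)) (sym t≡2s) (↔-trans *↔× (2↔Bool ×-↔ ↔-refl))

module LineAvoidance {t m′ : ℕ} (fr : Frame t (suc m′)) where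
  open FrameGeometry fr

  module _ (d : Bool) {p : Pt} (fb : FrameBlock) (p∈ : p ∈₃ tripleOf fb)
           (same : proj₁ p ≡ proj₁ (lineOf d (proj₁ fb))) where

    Code : Set
    Code = Fin m′ × (Bool × Fin s)

    code : (q : Pt) → proj₁ q ≢ proj₁ p → Code
    code q q≁p = punchOut (q≁p ∘ sym) , to halves (proj₂ q)

    code-injective : ∀ {q q′} (q≁p : proj₁ q ≢ proj₁ p) (q′≁p : proj₁ q′ ≢ proj₁ p) →
      code q q≁p ≡ code q′ q′≁p → q ≡ q′
    code-injective q≁p q′≁p eq =
      cong₂ _,_ (punchOut-injective (q≁p ∘ sym) (q′≁p ∘ sym) (cong proj₁ eq))
                (to-injective halves (cong proj₂ eq))

    otherLine : Fin m′ → Fin s → Idx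
    otherLine j x = punchIn (proj₁ p) j , x

    crossing : ∀ j x →
      ExactlyOne FrameBlock (λ fb′ → lineOf d (proj₁ fb′) ≡ otherLine j x × p ∈₃ tripleOf fb′)
    crossing j x = frameBlock-line d (otherLine j x) (punchInᵢ≢i (proj₁ p) j ∘ sym)

    blockOf : Maybe Code → FrameBlock
    blockOf nothing            = fb
    blockOf (just (j , _ , x)) = proj₁ (crossing j x)

    p∈blockOf : ∀ e → p ∈₃ tripleOf (blockOf e)
    p∈blockOf nothing            = p∈
    p∈blockOf (just (j , _ , x)) = proj₂ (proj₁ (proj₂ (crossing j x)))

    lineIndex : Maybe Code → Idx
    lineIndex nothing            = lineOf d (proj₁ fb)
    lineIndex (just (j , _ , x)) = otherLine j x

    lineOf-blockOf : ∀ e → lineOf d (proj₁ (blockOf e)) ≡ lineIndex e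
    lineOf-blockOf nothing            = refl
    lineOf-blockOf (just (j , _ , x)) = proj₁ (proj₁ (proj₂ (crossing j x)))

    partnerOf : Maybe Code → Pt
    partnerOf nothing            = partner fb p∈ false
    partnerOf e@(just (_ , b , _)) = partner (blockOf e) (p∈blockOf e) b

    partnerOf-∈ : ∀ e → partnerOf e ∈₃ tripleOf (blockOf e)
    partnerOf-∈ nothing            = partner-∈ fb p∈ false
    partnerOf-∈ e@(just (_ , b , _)) = partner-∈ (blockOf e) (p∈blockOf e) b

    partnerOf-group-≢ : ∀ e → proj₁ (partnerOf e) ≢ proj₁ p
    partnerOf-group-≢ nothing            = partner-group-≢ fb p∈ false
    partnerOf-group-≢ e@(just (_ , b , _)) = partner-group-≢ (blockOf e) (p∈blockOf e) b

    partnerOf-blockOf : ∀ {e e′} → partnerOf e ≡ partnerOf e′ → blockOf e ≡ blockOf e′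
    partnerOf-blockOf {e} {e′} eq = ExactlyOne-unique (frameBlock-pair (partnerOf-group-≢ e ∘ sym))
      (p∈blockOf e , partnerOf-∈ e)
      (p∈blockOf e′ , subst (_∈₃ tripleOf (blockOf e′)) (sym eq) (partnerOf-∈ e′))

    own-line-≢-otherLine : ∀ j x → lineOf d (proj₁ fb) ≢ otherLine j x
    own-line-≢-otherLine j x eq = punchInᵢ≢i (proj₁ p) j (sym (trans same (cong proj₁ eq)))

    partnerOf-on-line-injective : ∀ e e′ →
      lineIndex e ≡ lineIndex e′ → partnerOf e ≡ partnerOf e′ → e ≡ e′
    partnerOf-on-line-injective nothing nothing _ _ = refl
    partnerOf-on-line-injective nothing (just (j , _ , x)) l≡ _ =
      ⊥-elim (own-line-≢-otherLine j x l≡)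
    partnerOf-on-line-injective (just (j , _ , x)) nothing l≡ _ =
      ⊥-elim (own-line-≢-otherLine j x (sym l≡))
    partnerOf-on-line-injective e@(just (j , b , x)) (just (j′ , b′ , x′)) l≡ eq
      with refl ← punchIn-injective (proj₁ p) j j′ (cong proj₁ l≡) | refl ← cong proj₂ l≡ =
      cong (λ b → just (j , b , x)) (partner-injective (blockOf e) (p∈blockOf e) eq)

    partnerOf-injective : Injective _≡_ _≡_ partnerOf
    partnerOf-injective {e} {e′} eq = partnerOf-on-line-injective e e′
      (trans (sym (lineOf-blockOf e))
             (trans (cong (lineOf d ∘ proj₁) (partnerOf-blockOf {e} {e′} eq)) (lineOf-blockOf e′)))
      eq

    -- Each of the (m - 1) s lines of direction d in the other groups meets p in a block holding
    -- two partners of p; these (m - 1) t partners are distinct, so they are all the points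
    -- outside the group of p, leaving no room for a partner of p in its own block.
    absurd : ⊥
    absurd = no-injection-from-Maybe (Finite-× (m′ , ↔-refl) (Finite-× (2 , ↔-sym 2↔Bool) (s , ↔-refl)))
      (λ e → code (partnerOf e) (partnerOf-group-≢ e))
      (λ {e} {e′} → partnerOf-injective ∘ code-injective (partnerOf-group-≢ e) (partnerOf-group-≢ e′))

-- The frame axioms only say that a line covers every point outside its group exactly once;
-- that it meets no point of its own group needs the counting argument of LineAvoidance.
frameBlock-avoids-line-group : ∀ {t m} (fr : Frame t m) d (fb : FrameGeometry.FrameBlock fr) {p} →
  p ∈₃ FrameGeometry.tripleOf fr fb → proj₁ p ≢ proj₁ (lineOf d (proj₁ fb))
frameBlock-avoids-line-group {m = zero}    fr d fb {() , _}
frameBlock-avoids-line-group {m = suc m′} fr d fb p∈ same = LineAvoidance.absurd fr d fb p∈ same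

module Inflation {t m n : ℕ} (fr : Frame t m) (mols : ThreeMOLS n)
                 {K : Set} (I : NRStarDSTS (Maybe (Fin t × Fin n)) K) where
  open FrameGeometry fr
  module I = NRStarDSTS I

  L : Fin 3 → Fin n × Fin n → Fin n
  L k ρσ = proj₁ mols k (proj₁ ρσ) (proj₂ ρσ)

  latinLine : ∀ k d α β → ExactlyOne (Fin n) (λ v → L k (cellAt d α v) ≡ β)
  latinLine k false = proj₁ (proj₁ (proj₂ mols) k)
  latinLine k true  = proj₂ (proj₁ (proj₂ mols) k)

  orthogonal : ∀ {k k′} → k ≢ k′ → ∀ α β →
    ExactlyOne (Fin n × Fin n) (λ ρσ → L k ρσ ≡ α × L k′ ρσ ≡ β)
  orthogonal k≢k′ = proj₂ (proj₂ mols) _ _ k≢k′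

  Point : Set
  Point = Maybe (Pt × Fin n)

  lift : Fin m → Maybe (Fin t × Fin n) → Point
  lift i nothing        = nothing
  lift i (just (x , α)) = just ((i , x) , α)

  lift-injective : ∀ i → Injective _≡_ _≡_ (lift i)
  lift-injective i {nothing}     {nothing}     _  = refl
  lift-injective i {just (x , α)} {just (y , β)} eq =
    cong (λ ((_ , z) , γ) → just (z , γ)) (just-injective eq)

  lift-just-group : ∀ {i j u g} → lift j u ≡ lift i (just g) → j ≡ i
  lift-just-group {u = just _} eq = cong (proj₁ ∘ proj₁) (just-injective eq)

  lift-pair-group : ∀ {i j u v u′ v′} → u ≢ v →
    lift j u′ ≡ lift i u → lift j v′ ≡ lift i v → j ≡ i
  lift-pair-group {u = just _}                 _   eq _   = lift-just-group eq
  lift-pair-group {u = nothing} {v = just _}   _   _  eq′ = lift-just-group eq′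
  lift-pair-group {u = nothing} {v = nothing} u≢v _  _   = ⊥-elim (u≢v refl)

  lift-pair : ∀ {i j u v u′ v′} → u ≢ v → lift j u′ ≡ lift i u → lift j v′ ≡ lift i v →
    j ≡ i × u′ ≡ u × v′ ≡ v
  lift-pair u≢v eq eq′ with refl ← lift-pair-group u≢v eq eq′ =
    refl , lift-injective _ eq , lift-injective _ eq′

  Block : Set
  Block = (Fin m × K) ⊎ (FrameBlock × (Fin n × Fin n))

  inflatedPoint : FrameBlock → Fin n × Fin n → Fin 3 → Point
  inflatedPoint fb ρσ k = just (point (tripleOf fb) k , L k ρσ)

  inflatedPoint-injective : ∀ fb ρσ → Injective _≡_ _≡_ (inflatedPoint fb ρσ)
  inflatedPoint-injective fb ρσ =
    tripleOf-group-injective fb ∘ cong (proj₁ ∘ proj₁) ∘ just-injective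

  blocks : Block → Triple Point
  blocks (inj₁ (i , κ))   = mapTriple (lift i) (lift-injective i) (I.blocks κ)
  blocks (inj₂ (fb , ρσ)) = tabulateTriple (inflatedPoint fb ρσ) (inflatedPoint-injective fb ρσ)

  -- Via halves, the point (i , x) with to halves x = (d , X) labels the class of line (i , X)
  -- in direction d; its blocks are the inflated blocks of that line with Latin line α.
  classOfLine : Bool → Idx → Fin n → Point
  classOfLine d (i , X) α = just ((i , from halves (d , X)) , α)

  cls : Block × Bool → Point
  cls (inj₁ (i , κ) , d)   = lift i (I.cls (κ , d))
  cls (inj₂ (fb , ρσ) , d) = classOfLine d (lineOf d (proj₁ fb)) (lineOf d ρσ)

  classOfLine-injective : ∀ {d d′ X X′ α α′} → classOfLine d X α ≡ classOfLine d′ X′ α′ →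
    d ≡ d′ × X ≡ X′ × α ≡ α′
  classOfLine-injective eq with e ← just-injective eq
    with refl ← to-injective (↔-sym halves) (cong (proj₂ ∘ proj₁) e) =
    refl , cong₂ _,_ (cong (proj₁ ∘ proj₁) e) refl , cong proj₂ e

  classOfLine-halves : ∀ i x α →
    classOfLine (proj₁ (to halves x)) (i , proj₂ (to halves x)) α ≡ just ((i , x) , α)
  classOfLine-halves i x α = cong (λ z → just ((i , z) , α)) (strictlyInverseʳ halves x)

  classOfLine-group : ∀ {d X α i u} → classOfLine d X α ≡ lift i u → proj₁ X ≡ i
  classOfLine-group {u = just _} eq = cong (proj₁ ∘ proj₁) (just-injective eq)

  classOfLine≢∞ : ∀ {d X α} → classOfLine d X α ≢ nothing
  classOfLine≢∞ ()

  ∈inner⁻ : ∀ {x i κ} → x ∈₃ blocks (inj₁ (i , κ)) →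
    ∃[ u ] u ∈₃ I.blocks κ × x ≡ lift i u
  ∈inner⁻ {i = i} {κ} = ∈-mapTriple⁻ (lift i) (lift-injective i) (I.blocks κ)

  ∈inner⁺ : ∀ {u i κ} → u ∈₃ I.blocks κ → lift i u ∈₃ blocks (inj₁ (i , κ))
  ∈inner⁺ {i = i} {κ} = ∈-mapTriple⁺ (lift i) (lift-injective i) (I.blocks κ)

  ∈frame⁻ : ∀ {x fb ρσ} → x ∈₃ blocks (inj₂ (fb , ρσ)) → ∃[ k ] x ≡ inflatedPoint fb ρσ k
  ∈frame⁻ {fb = fb} {ρσ} =
    ∈-tabulateTriple⁻ (inflatedPoint fb ρσ) (inflatedPoint-injective fb ρσ)

  ∈frame⁺ : ∀ fb ρσ k {p α} → point (tripleOf fb) k ≡ p → L k ρσ ≡ α →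
    just (p , α) ∈₃ blocks (inj₂ (fb , ρσ))
  ∈frame⁺ fb ρσ k refl refl =
    ∈-tabulateTriple⁺ (inflatedPoint fb ρσ) (inflatedPoint-injective fb ρσ) k

  ∈frame-just⁻ : ∀ {p α fb ρσ} → just (p , α) ∈₃ blocks (inj₂ (fb , ρσ)) →
    ∃[ k ] point (tripleOf fb) k ≡ p × L k ρσ ≡ α
  ∈frame-just⁻ p∈ with k , eq ← ∈frame⁻ p∈ =
    k , sym (cong proj₁ (just-injective eq)) , sym (cong proj₂ (just-injective eq))

  ∞∉frame : ∀ {fb ρσ} → ¬ (nothing ∈₃ blocks (inj₂ (fb , ρσ)))
  ∞∉frame ∞∈ with ∈frame⁻ ∞∈
  ... | _ , ()

  frame-avoids-line-group : ∀ fb ρσ d {q α} → just (q , α) ∈₃ blocks (inj₂ (fb , ρσ)) →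
    proj₁ q ≢ proj₁ (lineOf d (proj₁ fb))
  frame-avoids-line-group fb ρσ d q∈ with k , refl , _ ← ∈frame-just⁻ q∈ =
    frameBlock-avoids-line-group fr d fb (point∈ (tripleOf fb) k)

  frame-no-inner-pair : ∀ {fb ρσ i u v} → u ≢ v →
    lift i u ∈₃ blocks (inj₂ (fb , ρσ)) → lift i v ∈₃ blocks (inj₂ (fb , ρσ)) → ⊥
  frame-no-inner-pair {u = nothing} _ u∈ _ = ∞∉frame u∈
  frame-no-inner-pair {v = nothing} _ _ v∈ = ∞∉frame v∈
  frame-no-inner-pair {fb = fb} {ρσ} {u = just _} {v = just _} u≢v u∈ v∈
    with k , p≡ , α≡ ← ∈frame-just⁻ u∈ | k′ , p≡′ , α≡′ ← ∈frame-just⁻ v∈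
    with refl ← tripleOf-group-injective fb {k} {k′} (trans (cong proj₁ p≡) (sym (cong proj₁ p≡′))) =
    u≢v (cong₂ (λ p α → just (proj₂ p , α)) (trans (sym p≡) p≡′) (trans (sym α≡) α≡′))

  inner-group : ∀ {q α j κ} → just (q , α) ∈₃ blocks (inj₁ (j , κ)) → proj₁ q ≡ j
  inner-group q∈ with just _ , _ , eq ← ∈inner⁻ q∈ = cong (proj₁ ∘ proj₁) (just-injective eq)

  frame-class-excludes : ∀ {fb ρσ d i u v} → cls (inj₂ (fb , ρσ) , d) ≡ lift i u →
    ¬ (lift i v ∈₃ blocks (inj₂ (fb , ρσ)))
  frame-class-excludes {u = nothing} eq _ = classOfLine≢∞ eq
  frame-class-excludes {v = nothing} _ v∈ = ∞∉frame v∈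
  frame-class-excludes {fb} {ρσ} {d} {u = just _} {v = just _} eq v∈ =
    frame-avoids-line-group fb ρσ d v∈ (sym (classOfLine-group eq))

  data PairView : Point → Point → Set where
    within : ∀ i {u v} → u ≢ v → PairView (lift i u) (lift i v)
    across : ∀ {p q} α β → proj₁ p ≢ proj₁ q → PairView (just (p , α)) (just (q , β))

  pairView : ∀ x y → x ≢ y → PairView x y
  pairView nothing             nothing             x≢y = ⊥-elim (x≢y refl)
  pairView nothing             (just ((i , y) , β)) _   = within i λ ()
  pairView (just ((i , x) , α)) nothing             _   = within i λ ()
  pairView (just ((i , x) , α)) (just ((j , y) , β)) x≢y with i ≟ j
  ... | yes refl = within i (x≢y ∘ cong (lift i))
  ... | no i≢j   = across α β i≢j

  innerPair : ∀ i {u v} → u ≢ v →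
    ExactlyOne Block (λ k → lift i u ∈₃ blocks k × lift i v ∈₃ blocks k)
  innerPair i {u} {v} u≢v with κ , (u∈ , v∈) , κ-unique ← I.isSTS u v u≢v =
    inj₁ (i , κ) , (∈inner⁺ u∈ , ∈inner⁺ v∈) , unique
    where
    unique : ∀ k → lift i u ∈₃ blocks k × lift i v ∈₃ blocks k → k ≡ inj₁ (i , κ)
    unique (inj₁ (j , κ′)) (u∈′ , v∈′)
      with u′ , u′∈ , eq ← ∈inner⁻ u∈′ | v′ , v′∈ , eq′ ← ∈inner⁻ v∈′
      with refl , refl , refl ← lift-pair u≢v (sym eq) (sym eq′) =
      cong (λ κ′ → inj₁ (i , κ′)) (κ-unique κ′ (u′∈ , v′∈))
    unique (inj₂ _) (u∈′ , v∈′) = ⊥-elim (frame-no-inner-pair u≢v u∈′ v∈′)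

  acrossPair : ∀ {p q} α β → proj₁ p ≢ proj₁ q →
    ExactlyOne Block (λ k → just (p , α) ∈₃ blocks k × just (q , β) ∈₃ blocks k)
  acrossPair {p} {q} α β p≁q with fb , (p∈ , q∈) , fb-unique ← frameBlock-pair p≁q
    with kp , p≡ ← ∈⇒point (tripleOf fb) p∈ | kq , q≡ ← ∈⇒point (tripleOf fb) q∈
    with ρσ , (α≡ , β≡) , ρσ-unique ←
           orthogonal (distinct-positions p≡ q≡ (p≁q ∘ cong proj₁)) α β =
    inj₂ (fb , ρσ) ,
    (∈frame⁺ fb ρσ kp (sym p≡) α≡ , ∈frame⁺ fb ρσ kq (sym q≡) β≡) ,
    unique
    where
    unique : ∀ k → just (p , α) ∈₃ blocks k × just (q , β) ∈₃ blocks k → k ≡ inj₂ (fb , ρσ)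
    unique (inj₁ _) (p∈′ , q∈′) =
      ⊥-elim (p≁q (trans (inner-group p∈′) (sym (inner-group q∈′))))
    unique (inj₂ (fb′ , ρσ′)) (p∈′ , q∈′)
      with k₁ , p≡′ , α≡′ ← ∈frame-just⁻ p∈′
         | k₂ , q≡′ , β≡′ ← ∈frame-just⁻ q∈′
      with refl ← fb-unique fb′ (subst (_∈₃ tripleOf fb′) p≡′ (point∈ _ k₁) ,
                                 subst (_∈₃ tripleOf fb′) q≡′ (point∈ _ k₂))
      with refl ← point-injective (tripleOf fb) {k₁} {kp} (trans p≡′ p≡)
         | refl ← point-injective (tripleOf fb) {k₂} {kq} (trans q≡′ q≡) =
      cong (λ ρσ → inj₂ (fb , ρσ)) (ρσ-unique ρσ′ (α≡′ , β≡′))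

  isSTS : ∀ x y → x ≢ y → ExactlyOne Block (λ k → x ∈₃ blocks k × y ∈₃ blocks k)
  isSTS x y x≢y with pairView x y x≢y
  ... | within i u≢v   = innerPair i u≢v
  ... | across α β p≁q = acrossPair α β p≁q

  innerCover : ∀ i {u v} → u ≢ v →
    ExactlyOne (Block × Bool) (λ γ → cls γ ≡ lift i u × lift i v ∈₃ blocks (proj₁ γ))
  innerCover i {u} {v} u≢v with (κ , d) , (cls≡ , v∈) , unique′ ← I.covers u v (u≢v ∘ sym) =
    (inj₁ (i , κ) , d) , (cong (lift i) cls≡ , ∈inner⁺ v∈) , unique
    where
    unique : ∀ γ → cls γ ≡ lift i u × lift i v ∈₃ blocks (proj₁ γ) → γ ≡ (inj₁ (i , κ) , d)
    unique (inj₁ (j , κ′) , d′) (cls≡′ , v∈′)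
      with v′ , v′∈ , eq ← ∈inner⁻ v∈′
      with refl , c≡ , refl ← lift-pair u≢v cls≡′ (sym eq) =
      cong (λ (κ , d) → inj₁ (i , κ) , d) (unique′ (κ′ , d′) (c≡ , v′∈))
    unique (inj₂ _ , _) (cls≡′ , v∈′) = ⊥-elim (frame-class-excludes cls≡′ v∈′)

  lineCover : ∀ d X α {q} β → proj₁ q ≢ proj₁ X →
    ExactlyOne (Block × Bool) (λ γ → cls γ ≡ classOfLine d X α × just (q , β) ∈₃ blocks (proj₁ γ))
  lineCover d X α {q} β q≁X
    with fb , (onX , q∈) , fb-unique ← frameBlock-line d X q≁X
    with k , q≡ ← ∈⇒point (tripleOf fb) q∈
    with v , Lv≡ , v-unique ← latinLine k d α β =
    (inj₂ (fb , cellAt d α v) , d) ,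
    (cong₂ (classOfLine d) onX (lineOf-cellAt d α v) , ∈frame⁺ fb _ k (sym q≡) Lv≡) ,
    unique
    where
    unique : ∀ γ → cls γ ≡ classOfLine d X α × just (q , β) ∈₃ blocks (proj₁ γ) →
             γ ≡ (inj₂ (fb , cellAt d α v) , d)
    unique (inj₁ _ , _) (cls≡′ , q∈′) =
      ⊥-elim (q≁X (trans (inner-group q∈′) (sym (classOfLine-group (sym cls≡′)))))
    unique (inj₂ (fb′ , ρσ′) , d′) (cls≡′ , q∈′)
      with refl , onX′ , α≡ ← classOfLine-injective cls≡′
      with k′ , q≡′ , β≡ ← ∈frame-just⁻ q∈′
      with refl ← fb-unique fb′ (onX′ , subst (_∈₃ tripleOf fb′) q≡′ (point∈ _ k′))
      with refl ← point-injective (tripleOf fb) {k′} {k} (trans q≡′ q≡) =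
      cong (λ ρσ → inj₂ (fb , ρσ) , d)
        (cellAt-≡ d α≡ (v-unique _ (trans (cong (L k) (sym (cellAt-≡ d α≡ refl))) β≡)))

  frameCover : ∀ {p q} α β → proj₁ q ≢ proj₁ p →
    ExactlyOne (Block × Bool) (λ γ → cls γ ≡ just (p , α) × just (q , β) ∈₃ blocks (proj₁ γ))
  frameCover {i , x} {q} α β q≁p =
    subst (λ r → ExactlyOne (Block × Bool) (λ γ → cls γ ≡ r × just (q , β) ∈₃ blocks (proj₁ γ)))
          (classOfLine-halves i x α)
          (lineCover (proj₁ (to halves x)) (i , proj₂ (to halves x)) α β q≁p)

  covers : ∀ r x → x ≢ r →
    ExactlyOne (Block × Bool) (λ γ → cls γ ≡ r × x ∈₃ blocks (proj₁ γ))
  covers r x x≢r with pairView r x (x≢r ∘ sym)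
  ... | within i u≢v   = innerCover i u≢v
  ... | across α β p≁q = frameCover α β (p≁q ∘ sym)

  missesOwn : ∀ γ → ¬ (cls γ ∈₃ blocks (proj₁ γ))
  missesOwn (inj₁ (i , κ) , d) own =
    I.missesOwn (κ , d) (∈-mapTriple-injective (lift i) (lift-injective i) (I.blocks κ) own)
  missesOwn (inj₂ (fb , ρσ) , d) own = frame-avoids-line-group fb ρσ d own refl

  -- The two copies of a frame block lie in the classes of its row and of its column, whose
  -- groups differ, while the classes of an inner block of group i are ∞ or lie in group i.
  inner-frame-share : ∀ fb ρσ {d d′ i u u′} →
    cls (inj₂ (fb , ρσ) , d) ≡ lift i u → cls (inj₂ (fb , ρσ) , d′) ≡ lift i u′ →
    cls (inj₂ (fb , ρσ) , d) ≢ cls (inj₂ (fb , ρσ) , d′) → ⊥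
  inner-frame-share fb ρσ {d} {d′} eq eq′ r≢r′ =
    frameBlock-lineGroups-≢ fb d≢d′ (trans (classOfLine-group eq) (sym (classOfLine-group eq′)))
    where
    d≢d′ : d ≢ d′
    d≢d′ refl = r≢r′ refl

  selfOrth : ∀ {k k′ b₁ b₂ b₁′ b₂′} →
    cls (k , b₁) ≡ cls (k′ , b₂) → cls (k , b₁′) ≡ cls (k′ , b₂′) →
    cls (k , b₁) ≢ cls (k , b₁′) → k ≡ k′
  selfOrth {inj₁ (i , κ)} {inj₁ (i′ , κ′)} eq eq′ r≢r′
    with refl , c≡ , c≡′ ← lift-pair (r≢r′ ∘ cong (lift i)) (sym eq) (sym eq′) =
    cong (λ κ → inj₁ (i , κ)) (I.selfOrth (sym c≡) (sym c≡′) (r≢r′ ∘ cong (lift i)))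
  selfOrth {inj₁ _} {inj₂ (fb , ρσ)} eq eq′ r≢r′ =
    ⊥-elim (inner-frame-share fb ρσ (sym eq) (sym eq′) (λ e → r≢r′ (trans eq (trans e (sym eq′)))))
  selfOrth {inj₂ (fb , ρσ)} {inj₁ _} eq eq′ r≢r′ =
    ⊥-elim (inner-frame-share fb ρσ eq eq′ r≢r′)
  selfOrth {inj₂ (fb , ρσ)} {inj₂ (fb′ , ρσ′)} {b₁} {b₂} {b₁′} {b₂′} eq eq′ r≢r′
    with refl , line≡ , sym≡ ← classOfLine-injective eq
    with refl , line≡′ , sym≡′ ← classOfLine-injective eq′ =
    cong₂ (λ fb ρσ → inj₂ (fb , ρσ))
          (FrameBlock-≡ (lineOf-both b₁≢b₁′ line≡ line≡′)) (lineOf-both b₁≢b₁′ sym≡ sym≡′)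
    where
    b₁≢b₁′ : b₁ ≢ b₁′
    b₁≢b₁′ refl = r≢r′ refl

  inflation : NRStarDSTS Point Block
  inflation = record
    { blocks = blocks ; isSTS = isSTS ; cls = cls
    ; missesOwn = missesOwn ; covers = covers ; selfOrth = selfOrth }

  points↔ : Point ↔ Fin (t * m * n + 1)
  points↔ = Maybe↔Fin-+1 (↔-trans (↔-trans (×-comm _ _) (↔-sym *↔×) ×-↔ ↔-refl) (↔-sym *↔×))

  Block-finite : Finite K → Finite Block
  Block-finite K-finite = Finite-⊎ (Finite-× (Finite-Fin m) K-finite)
    (Finite-× (Finite-Σ-T (is-just ∘ content) (Finite-× idx idx)) (Finite-× (Finite-Fin n) (Finite-Fin n)))
    where
    idx = Finite-× (Finite-Fin m) (Finite-Fin s)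


theorem4p5 : ∀ (t m n : ℕ) → Frame t m → ThreeMOLS n → NRDSTS (t * n + 1) →
    NRDSTS (t * m * n + 1)
theorem4p5 t m n fr mols D = toNRDSTS (relabel inflation points↔ (proj₂ (Block-finite (Finite-Fin _))))
  where
  inner↔ : Maybe (Fin t × Fin n) ↔ Fin (t * n + 1)
  inner↔ = Maybe↔Fin-+1 (↔-sym *↔×)

  open Inflation fr mols (relabel (fromNRDSTS D) (↔-sym inner↔) ↔-refl)
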